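{- Let $J=(V,E_J)$ be a directed or undirected graph and let $T\subseteq V$ be an independent set of $J$ that is $k$-connected in $J$. Let $\mathcal{F}=\{(X\cap T,X^+\cap T):(X,X^+)\text{ is a }(T,k)\text{ -tight biset in }J\}$. Then $\mathcal{F}$ is a crossing and $k$-regular biset-family on $T$, and the reverse family $\bar{\mathcal{F}}$ of $\mathcal{F}$ is also crossing and $k$-regular. Furthermore, if $J$ is undirected then $\mathcal{F}$ is symmetric, i.e. $\mathcal{F}=\bar{\mathcal{F}}$.
   Context: $T$ is $k$-connected in $J$ if for every $s\in T$ and every $v\in T\setminus\{s\}$, $J$ has $k$ internally-disjoint $vs$-paths. A biset on a groundset $U$ is an ordered pair $\hat X=(X,X^+)$ with $X\subseteq X^+\subseteq U$; $\Gamma(\hat X)=X^+\setminus X$ and $X^*=U\setminus X^+$. A biset $(X,X^+)$ on $V$ is $(T,k)$-tight in $J$ if $X\cap T\ne\emptyset$, $X^*\cap T\neq\emptyset$, $X^+$ is the union of $X$ and the set of neighbors of $X$ in $J$ (nodes outside $X$ joined by an edge from $X$), and $|\Gamma(\hat X)|=k$. For bisets on $T$: $\hat X\cap\hat Y=(X\cap Y,X^+\cap Y^+)$, $\hat X\cup\hat Y=(X\cup Y,X^+\cup Y^+)$; $\hat X,\hat Y$ intersect if $X\cap Y\ne\emptyset$, and cross if moreover $X^*\cap Y^*\neq\emptyset$ (with $X^*=T\setminus X^+$). A biset-family $\mathcal{F}$ on $T$ is crossing if $\hat X\cap\hat Y,\hat X\cup\hat Y\in\mathcal{F}$ whenever $\hat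 X,\hat Y\in\mathcal{F}$ cross; it is $k$-regular if $|\Gamma(\hat X)|\le k$ for all $\hat X\in\mathcal{F}$ and $\hat X\cap\hat Y,\hat X\cup\hat Y\in\mathcal{F}$ for all intersecting $\hat X,\hat Y\in\mathcal{F}$ with $|X\cup Y|\le|T|-k-1$. The reverse family is $\bar{\mathcal{F}}=\{(T\setminus X^+,T\setminus X):\hat X\in\mathcal{F}\}$. -}

module Defs where

open import Data.Nat using (ℕ; _+_; _≤_)
open import Data.Fin using (Fin)
open import Data.Fin.Subset using (Subset; _∈_; _∉_; _⊆_; _∩_; _∪_; _─_; ∣_∣; Nonempty; ⊤)
open import Data.List using (List; []; _∷_; _++_)
open import Data.List.Relation.Unary.Linked using (Linked)
open import Data.List.Relation.Unary.Unique.Propositional using (Unique)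
open import Data.List.Membership.Propositional using () renaming (_∈_ to _∈ₗ_)
open import Data.Product using (Σ; ∃; _×_; _,_; proj₁; proj₂)
open import Data.Sum using (_⊎_)
open import Relation.Binary.PropositionalEquality using (_≡_; _≢_)
open import Relation.Nullary using (¬_)

variable
  n : ℕ

-- A graph on vertex set V = Fin n is given by its edge relation E
-- (E u v : there is an edge from u to v).  Undirected graphs are those
-- with a symmetric edge relation.
Graph : ℕ → Set₁
Graph n = Fin n → Fin n → Set

Undirected : Graph n → Set
Undirected E = ∀ u v → E u v → E v u

Independent : Graph n → Subset n → Set
Independent E T = ∀ u v → u ∈ T → v ∈ T → ¬ E u v

-- a vs-path in J: v, then the internal vertices, then s; consecutive
-- vertices joined by an edge (directed from v towards s), no vertex repeated.
record Path (E : Graph n) (v s : Fin n) : Set where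
  field
    inner  : List (Fin n)
    linked : Linked E (v ∷ inner ++ s ∷ [])
    simple : Unique (v ∷ inner ++ s ∷ [])
open Path public

InternallyDisjointPaths : (E : Graph n) (k : ℕ) (v s : Fin n) → Set
InternallyDisjointPaths E k v s =
  Σ (Fin k → Path E v s) λ P →
    ∀ i j → i ≢ j → ∀ x → x ∈ₗ inner (P i) → ¬ (x ∈ₗ inner (P j))

KConnected : (E : Graph n) (T : Subset n) (k : ℕ) → Set
KConnected E T k =
  ∀ s v → s ∈ T → v ∈ T → v ≢ s → InternallyDisjointPaths E k v s

-- bisets (on a groundset Fin n); the groundset of bisets "on T" is
-- recorded separately by the predicate IsBisetOn.
Biset : ℕ → Set
Biset n = Subset n × Subset n

IsBisetOn : Subset n → Biset n → Set
IsBisetOn U (X , X⁺) = X ⊆ X⁺ × X⁺ ⊆ U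

Γ : Biset n → Subset n
Γ (X , X⁺) = X⁺ ─ X

star : Subset n → Biset n → Subset n
star U (X , X⁺) = U ─ X⁺

_∩ᵇ_ : Biset n → Biset n → Biset n
(X , X⁺) ∩ᵇ (Y , Y⁺) = (X ∩ Y , X⁺ ∩ Y⁺)

_∪ᵇ_ : Biset n → Biset n → Biset n
(X , X⁺) ∪ᵇ (Y , Y⁺) = (X ∪ Y , X⁺ ∪ Y⁺)

Tight : (E : Graph n) (T : Subset n) (k : ℕ) → Biset n → Set
Tight {n} E T k (X , X⁺) =
  X ⊆ X⁺ ×
  Nonempty (X ∩ T) ×
  Nonempty ((⊤ ─ X⁺) ∩ T) ×
  (∀ (u : Fin n) → (u ∈ X⁺ → (u ∈ X ⊎ (u ∉ X × ∃ λ x → x ∈ X × E x u)))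
                 × ((u ∈ X ⊎ (u ∉ X × ∃ λ x → x ∈ X × E x u)) → u ∈ X⁺)) ×
  ∣ X⁺ ─ X ∣ ≡ k

Family : ℕ → Set₁
Family n = Biset n → Set

tightFamily : (E : Graph n) (T : Subset n) (k : ℕ) → Family n
tightFamily {n} E T k (A , A⁺) =
  ∃ λ (Xh : Biset n) → Tight E T k Xh ×
    A ≡ proj₁ Xh ∩ T × A⁺ ≡ proj₂ Xh ∩ T

reverse : Subset n → Family n → Family n
reverse {n} T F (A , A⁺) =
  ∃ λ (Xh : Biset n) → F Xh × A ≡ T ─ proj₂ Xh × A⁺ ≡ T ─ proj₁ Xh

BisetFamilyOn : Subset n → Family n → Set
BisetFamilyOn T F = ∀ Xh → F Xh → IsBisetOn T Xh

Intersect : Biset n → Biset n → Set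
Intersect (X , _) (Y , _) = Nonempty (X ∩ Y)

Cross : Subset n → Biset n → Biset n → Set
Cross T Xh Yh = Intersect Xh Yh × Nonempty (star T Xh ∩ star T Yh)

Crossing : Subset n → Family n → Set
Crossing T F = ∀ Xh Yh → F Xh → F Yh → Cross T Xh Yh →
  F (Xh ∩ᵇ Yh) × F (Xh ∪ᵇ Yh)

-- k-regular; |X ∪ Y| ≤ |T| - k - 1 written as |X ∪ Y| + k + 1 ≤ |T|
Regular : Subset n → ℕ → Family n → Set
Regular T k F =
  (∀ Xh → F Xh → ∣ Γ Xh ∣ ≤ k) ×
  (∀ Xh Yh → F Xh → F Yh → Intersect Xh Yh →
     ∣ proj₁ Xh ∪ proj₁ Yh ∣ + k + 1 ≤ ∣ T ∣ →
     F (Xh ∩ᵇ Yh) × F (Xh ∪ᵇ Yh))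

SameFamily : Family n → Family n → Set
SameFamily F G = ∀ Xh → (F Xh → G Xh) × (G Xh → F Xh)

module Submission where

-- The key input is the easy
-- direction of Menger's theorem: if (Z , Z⁺) is closed (Z⁺ contains Z and its
-- out-neighbours) and splits T, the k internally-disjoint paths leave Z through
-- k distinct vertices of Γ = Z⁺ ∖ Z entered from Z.  So |Γ| ≥ k, and if
-- |Γ| ≤ k these exits fill Γ and the biset is tight ('tight-intro').
-- Closedness is preserved by ∩ and ∪ and |Γ| is submodular, so two tight
-- bisets with a common terminal inside and outside have tight ∩ and ∪
-- (crossing).  Counting terminals shows that intersecting members with a small
-- union have such a common outside terminal (dually, for the reverse family, a
-- common inside one), giving regularity.  In an undirected graph complements
-- of tight bisets are tight, so F equals its reverse.

open import Defs
open import Data.Nat using (ℕ; suc; _+_; _≤_; z≤n; s≤s)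
open import Data.Nat.Properties
  using (+-suc; +-comm; +-mono-≤; +-monoʳ-≤; +-cancelˡ-≤; ≤-trans; ≤-antisym; ≤-refl; ≤-reflexive;
         m≤n+m; n≮n; <⇒≱; module ≤-Reasoning)
open import Data.Fin using (Fin; zero; suc; _≟_)
open import Data.Fin.Properties using (any?; suc-injective; 0≢1+n)
open import Data.Fin.Subset
  using (Subset; _∈_; _∉_; _⊆_; _∩_; _∪_; _─_; _-_; ∣_∣; Nonempty; ⊤; inside; outside)
open import Data.Fin.Subset.Properties
  using (_∈?_; nonempty?; x∈p∩q⁺; x∈p∩q⁻; x∈p∪q⁺; x∈p∪q⁻; x∈p∧x∉q⇒x∈p─q; p─q⊆p; ∈⊤;
         ⊆-antisym; ∩-distribʳ-∪;
         p⊆q⇒∣p∣≤∣q∣; p∩q⊆p; p⊆p∪q; x∈p∧x≢y⇒x∈p-y; x∈p⇒∣p-x∣<∣p∣)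
open import Data.Vec using ([]; _∷_; here; there)
open import Data.List using (List; []; _∷_; _++_)
open import Data.List.Relation.Unary.Linked using (Linked; _∷_)
open import Data.List.Relation.Unary.Any using (here; there)
open import Data.List.Membership.Propositional using () renaming (_∈_ to _∈ₗ_)
open import Data.List.Membership.Propositional.Properties using (∈-++⁺ʳ; ∈-++⁻)
open import Data.Product using (∃; _×_; _,_; proj₁; proj₂)
open import Data.Sum using (_⊎_; inj₁; inj₂; [_,_]) renaming (map to ⊎-map)
open import Data.Empty using (⊥; ⊥-elim)
open import Function using (_∘_)
open import Function.Definitions using (Injective)
open import Relation.Binary.PropositionalEquality
  using (_≡_; refl; sym; trans; cong; cong₂; subst; subst₂; module ≡-Reasoning)
open import Relation.Nullary using (¬_; yes; no)

∩⁻ : ∀ {m} {x : Fin m} {p q : Subset m} → x ∈ p ∩ q → x ∈ p × x ∈ q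
∩⁻ {p = p} {q} = x∈p∩q⁻ p q

∩⁺ : ∀ {m} {x : Fin m} {p q : Subset m} → x ∈ p → x ∈ q → x ∈ p ∩ q
∩⁺ x∈p x∈q = x∈p∩q⁺ (x∈p , x∈q)

∪⁻ : ∀ {m} {x : Fin m} {p q : Subset m} → x ∈ p ∪ q → x ∈ p ⊎ x ∈ q
∪⁻ {p = p} {q} = x∈p∪q⁻ p q

─⁺ : ∀ {m} {x : Fin m} {p q : Subset m} → x ∈ p → x ∉ q → x ∈ p ─ q
─⁺ = x∈p∧x∉q⇒x∈p─q

─-excludes : ∀ {m} {x : Fin m} {p q : Subset m} → x ∈ p ─ q → x ∉ q
─-excludes {p = _ ∷ p} {_ ∷ q} (there x∈) (there x∈q) = ─-excludes {p = p} {q} x∈ x∈q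

─⁻ : ∀ {m} {x : Fin m} {p q : Subset m} → x ∈ p ─ q → x ∈ p × x ∉ q
─⁻ {p = p} {q} x∈ = p─q⊆p p q x∈ , ─-excludes {p = p} {q} x∈

outside⁺ : ∀ {m} {x : Fin m} {A T : Subset m} → x ∉ A → x ∈ T → x ∈ (⊤ ─ A) ∩ T
outside⁺ x∉A x∈T = ∩⁺ (─⁺ ∈⊤ x∉A) x∈T

outside⁻ : ∀ {m} {x : Fin m} {A T : Subset m} → x ∈ (⊤ ─ A) ∩ T → x ∉ A × x ∈ T
outside⁻ x∈ = proj₂ (─⁻ (proj₁ (∩⁻ x∈))) , proj₂ (∩⁻ x∈)

inside-of-no-outside : ∀ {m} {x : Fin m} {A T : Subset m} → ¬ Nonempty ((⊤ ─ A) ∩ T) → x ∈ T → x ∈ A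
inside-of-no-outside {x = x} {A} none x∈T with x ∈? A
... | yes x∈A = x∈A
... | no x∉A  = ⊥-elim (none (x , outside⁺ x∉A x∈T))

inside-mono : ∀ {m} {A B T : Subset m} → A ⊆ B → Nonempty (A ∩ T) → Nonempty (B ∩ T)
inside-mono A⊆B (x , x∈) = x , ∩⁺ (A⊆B (proj₁ (∩⁻ x∈))) (proj₂ (∩⁻ x∈))

outside-anti : ∀ {m} {A B T : Subset m} → A ⊆ B → Nonempty ((⊤ ─ B) ∩ T) → Nonempty ((⊤ ─ A) ∩ T)
outside-anti A⊆B (x , x∈) = x , outside⁺ (proj₁ (outside⁻ x∈) ∘ A⊆B) (proj₂ (outside⁻ x∈))

∩⊆∪ : ∀ {m} (A B : Subset m) → A ∩ B ⊆ A ∪ B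
∩⊆∪ A B = x∈p∪q⁺ ∘ inj₁ ∘ proj₁ ∘ ∩⁻

∩-restrict : ∀ {m} (X Y T : Subset m) → (X ∩ T) ∩ (Y ∩ T) ≡ (X ∩ Y) ∩ T
∩-restrict X Y T = ⊆-antisym to from
  where
  to : (X ∩ T) ∩ (Y ∩ T) ⊆ (X ∩ Y) ∩ T
  to x∈ with ∩⁻ x∈
  ... | x∈XT , x∈YT = ∩⁺ (∩⁺ (proj₁ (∩⁻ x∈XT)) (proj₁ (∩⁻ x∈YT))) (proj₂ (∩⁻ x∈XT))
  from : (X ∩ Y) ∩ T ⊆ (X ∩ T) ∩ (Y ∩ T)
  from x∈ with ∩⁻ x∈
  ... | x∈XY , x∈T = ∩⁺ (∩⁺ (proj₁ (∩⁻ x∈XY)) x∈T) (∩⁺ (proj₂ (∩⁻ x∈XY)) x∈T)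

∪-restrict : ∀ {m} (X Y T : Subset m) → (X ∩ T) ∪ (Y ∩ T) ≡ (X ∪ Y) ∩ T
∪-restrict X Y T = sym (∩-distribʳ-∪ T X Y)

─-∩ : ∀ {m} (T A B : Subset m) → (T ─ A) ∩ (T ─ B) ≡ T ─ (A ∪ B)
─-∩ T A B = ⊆-antisym to from
  where
  to : (T ─ A) ∩ (T ─ B) ⊆ T ─ (A ∪ B)
  to x∈ with ∩⁻ x∈
  ... | x∈T─A , x∈T─B =
    ─⁺ (proj₁ (─⁻ x∈T─A)) ([ proj₂ (─⁻ x∈T─A) , proj₂ (─⁻ x∈T─B) ] ∘ ∪⁻)
  from : T ─ (A ∪ B) ⊆ (T ─ A) ∩ (T ─ B)
  from x∈ with ─⁻ x∈
  ... | x∈T , x∉A∪B = ∩⁺ (─⁺ x∈T (x∉A∪B ∘ x∈p∪q⁺ ∘ inj₁)) (─⁺ x∈T (x∉A∪B ∘ x∈p∪q⁺ ∘ inj₂))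

─-∪ : ∀ {m} (T A B : Subset m) → (T ─ A) ∪ (T ─ B) ≡ T ─ (A ∩ B)
─-∪ T A B = ⊆-antisym to from
  where
  to : (T ─ A) ∪ (T ─ B) ⊆ T ─ (A ∩ B)
  to x∈ with ∪⁻ x∈
  ... | inj₁ x∈T─A = ─⁺ (proj₁ (─⁻ x∈T─A)) (proj₂ (─⁻ x∈T─A) ∘ proj₁ ∘ ∩⁻)
  ... | inj₂ x∈T─B = ─⁺ (proj₁ (─⁻ x∈T─B)) (proj₂ (─⁻ x∈T─B) ∘ proj₂ ∘ ∩⁻)
  from : T ─ (A ∩ B) ⊆ (T ─ A) ∪ (T ─ B)
  from {x} x∈ with ─⁻ x∈ | x ∈? A
  ... | x∈T , x∉A∩B | yes x∈A = x∈p∪q⁺ (inj₂ (─⁺ x∈T (x∉A∩B ∘ ∩⁺ x∈A)))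
  ... | x∈T , _     | no x∉A  = x∈p∪q⁺ (inj₁ (─⁺ x∈T x∉A))

complement-restrict : ∀ {m} (P T : Subset m) → T ─ (P ∩ T) ≡ (⊤ ─ P) ∩ T
complement-restrict P T = ⊆-antisym to from
  where
  to : T ─ (P ∩ T) ⊆ (⊤ ─ P) ∩ T
  to x∈ with ─⁻ x∈
  ... | x∈T , x∉PT = outside⁺ (λ x∈P → x∉PT (∩⁺ x∈P x∈T)) x∈T
  from : (⊤ ─ P) ∩ T ⊆ T ─ (P ∩ T)
  from x∈ with outside⁻ x∈
  ... | x∉P , x∈T = ─⁺ x∈T (x∉P ∘ proj₁ ∘ ∩⁻)

restrict-as-complement : ∀ {m} (P T : Subset m) → P ∩ T ≡ T ─ ((⊤ ─ P) ∩ T)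
restrict-as-complement P T = ⊆-antisym to from
  where
  to : P ∩ T ⊆ T ─ ((⊤ ─ P) ∩ T)
  to x∈ with ∩⁻ x∈
  ... | x∈P , x∈T = ─⁺ x∈T (λ x∈' → proj₁ (outside⁻ x∈') x∈P)
  from : T ─ ((⊤ ─ P) ∩ T) ⊆ P ∩ T
  from {x} x∈ with ─⁻ x∈ | x ∈? P
  ... | x∈T , _     | yes x∈P = ∩⁺ x∈P x∈T
  ... | x∈T , x∉rest | no x∉P = ⊥-elim (x∉rest (outside⁺ x∉P x∈T))

+-suc-both : ∀ {a b c d : ℕ} → a + b ≡ c + d → a + suc b ≡ c + suc d
+-suc-both {a} {b} {c} {d} eq = trans (+-suc a b) (trans (cong suc eq) (sym (+-suc c d)))

∣∩∣+∣∪∣ : ∀ {m} (p q : Subset m) → ∣ p ∩ q ∣ + ∣ p ∪ q ∣ ≡ ∣ p ∣ + ∣ q ∣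
∣∩∣+∣∪∣ []            []            = refl
∣∩∣+∣∪∣ (inside ∷ p)  (inside ∷ q)  = cong suc (+-suc-both (∣∩∣+∣∪∣ p q))
∣∩∣+∣∪∣ (inside ∷ p)  (outside ∷ q) = trans (+-suc ∣ p ∩ q ∣ ∣ p ∪ q ∣) (cong suc (∣∩∣+∣∪∣ p q))
∣∩∣+∣∪∣ (outside ∷ p) (inside ∷ q)  = +-suc-both (∣∩∣+∣∪∣ p q)
∣∩∣+∣∪∣ (outside ∷ p) (outside ∷ q) = ∣∩∣+∣∪∣ p q

∣∪∣≤ : ∀ {m} (p q : Subset m) → ∣ p ∪ q ∣ ≤ ∣ p ∣ + ∣ q ∣
∣∪∣≤ p q = subst (∣ p ∪ q ∣ ≤_) (∣∩∣+∣∪∣ p q) (m≤n+m ∣ p ∪ q ∣ ∣ p ∩ q ∣)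

¬-covered : ∀ {m} {T A G : Subset m} {k : ℕ} →
  T ⊆ A ∪ G → ∣ G ∣ ≤ k → ∣ A ∣ + k + 1 ≤ ∣ T ∣ → ⊥
¬-covered {T = T} {A} {G} {k} T⊆A∪G G≤k big =
  n≮n (∣ A ∣ + k) (subst (_≤ ∣ A ∣ + k) (+-comm (∣ A ∣ + k) 1) too-big)
  where
  open ≤-Reasoning
  too-big : ∣ A ∣ + k + 1 ≤ ∣ A ∣ + k
  too-big = begin
    ∣ A ∣ + k + 1  ≤⟨ big ⟩
    ∣ T ∣          ≤⟨ p⊆q⇒∣p∣≤∣q∣ T⊆A∪G ⟩
    ∣ A ∪ G ∣      ≤⟨ ∣∪∣≤ A G ⟩
    ∣ A ∣ + ∣ G ∣  ≤⟨ +-monoʳ-≤ ∣ A ∣ G≤k ⟩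
    ∣ A ∣ + k      ∎

≤-from-sum : ∀ {a b k : ℕ} → a + b ≤ k + k → k ≤ a → b ≤ k
≤-from-sum {a} {b} {k} a+b≤2k k≤a = +-cancelˡ-≤ k b k (≤-trans (+-mono-≤ k≤a (≤-refl {b})) a+b≤2k)

injection-≤ : ∀ {m k} {S : Subset m} (f : Fin k → Fin m) →
  Injective _≡_ _≡_ f → (∀ i → f i ∈ S) → k ≤ ∣ S ∣
injection-≤ {k = 0}     f f-inj f∈S = z≤n
injection-≤ {k = suc k} {S} f f-inj f∈S =
  ≤-trans (s≤s (injection-≤ (f ∘ suc) (suc-injective ∘ f-inj) rest∈)) (x∈p⇒∣p-x∣<∣p∣ (f∈S zero))
  where
  rest∈ : ∀ i → f (suc i) ∈ S - f zero
  rest∈ i = x∈p∧x≢y⇒x∈p-y (f∈S (suc i)) (λ eq → 0≢1+n (sym (f-inj eq)))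

injection-onto : ∀ {m k} {S : Subset m} (f : Fin k → Fin m) →
  Injective _≡_ _≡_ f → (∀ i → f i ∈ S) → ∣ S ∣ ≤ k → ∀ {u} → u ∈ S → ∃ λ i → f i ≡ u
injection-onto {S = S} f f-inj f∈S S≤k {u} u∈S with any? (λ i → f i ≟ u)
... | yes hit = hit
... | no miss = ⊥-elim (<⇒≱ (x∈p⇒∣p-x∣<∣p∣ u∈S) (≤-trans S≤k (injection-≤ f f-inj avoid-u)))
  where
  avoid-u : ∀ i → f i ∈ S - u
  avoid-u i = x∈p∧x≢y⇒x∈p-y (f∈S i) (λ eq → miss (i , eq))

-- The boundary size |Γ| is submodular on bisets (no inclusion X ⊆ X⁺ needed):
-- Γ(X̂ ∩ Ŷ) ∩ Γ(X̂ ∪ Ŷ) ⊆ ΓX̂ ∩ ΓŶ and Γ(X̂ ∩ Ŷ) ∪ Γ(X̂ ∪ Ŷ) ⊆ ΓX̂ ∪ ΓŶ,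
-- then apply the modular law on both sides.
Γ-submodular : ∀ {m} (Xh Yh : Biset m) → ∣ Γ (Xh ∩ᵇ Yh) ∣ + ∣ Γ (Xh ∪ᵇ Yh) ∣ ≤ ∣ Γ Xh ∣ + ∣ Γ Yh ∣
Γ-submodular Xh@(X , X⁺) Yh@(Y , Y⁺) = begin
  ∣ ΓI ∣ + ∣ ΓU ∣                    ≡⟨ sym (∣∩∣+∣∪∣ ΓI ΓU) ⟩
  ∣ ΓI ∩ ΓU ∣ + ∣ ΓI ∪ ΓU ∣          ≤⟨ +-mono-≤ (p⊆q⇒∣p∣≤∣q∣ meet⊆) (p⊆q⇒∣p∣≤∣q∣ join⊆) ⟩
  ∣ Γ Xh ∩ Γ Yh ∣ + ∣ Γ Xh ∪ Γ Yh ∣  ≡⟨ ∣∩∣+∣∪∣ (Γ Xh) (Γ Yh) ⟩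
  ∣ Γ Xh ∣ + ∣ Γ Yh ∣                ∎
  where
  open ≤-Reasoning
  ΓI = Γ (Xh ∩ᵇ Yh)
  ΓU = Γ (Xh ∪ᵇ Yh)
  meet⊆ : ΓI ∩ ΓU ⊆ Γ Xh ∩ Γ Yh
  meet⊆ u∈ with ∩⁻ u∈
  ... | u∈ΓI , u∈ΓU with ∩⁻ (proj₁ (─⁻ u∈ΓI)) | proj₂ (─⁻ u∈ΓU)
  ... | u∈X⁺ , u∈Y⁺ | u∉X∪Y = ∩⁺ (─⁺ u∈X⁺ (u∉X∪Y ∘ x∈p∪q⁺ ∘ inj₁)) (─⁺ u∈Y⁺ (u∉X∪Y ∘ x∈p∪q⁺ ∘ inj₂))
  join⊆ : ΓI ∪ ΓU ⊆ Γ Xh ∪ Γ Yh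
  join⊆ {u} u∈ with ∪⁻ u∈
  ... | inj₁ u∈ΓI with ∩⁻ (proj₁ (─⁻ u∈ΓI)) | proj₂ (─⁻ u∈ΓI) | u ∈? X
  ...   | _ , u∈Y⁺ | u∉X∩Y | yes u∈X = x∈p∪q⁺ (inj₂ (─⁺ u∈Y⁺ (u∉X∩Y ∘ ∩⁺ u∈X)))
  ...   | u∈X⁺ , _ | _     | no u∉X  = x∈p∪q⁺ (inj₁ (─⁺ u∈X⁺ u∉X))
  join⊆ u∈ | inj₂ u∈ΓU with ─⁻ u∈ΓU
  ... | u∈X⁺∪Y⁺ , u∉X∪Y with ∪⁻ u∈X⁺∪Y⁺
  ...   | inj₁ u∈X⁺ = x∈p∪q⁺ (inj₁ (─⁺ u∈X⁺ (u∉X∪Y ∘ x∈p∪q⁺ ∘ inj₁)))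
  ...   | inj₂ u∈Y⁺ = x∈p∪q⁺ (inj₂ (─⁺ u∈Y⁺ (u∉X∪Y ∘ x∈p∪q⁺ ∘ inj₂)))

-- The biset complementary to (X , X⁺) within a groundset U; the reverse
-- family consists of the complements within T.
co : ∀ {m} → Subset m → Biset m → Biset m
co U (X , X⁺) = (U ─ X⁺ , U ─ X)

Γ-co : ∀ {m} (U : Subset m) (Xh : Biset m) → Γ (co U Xh) ⊆ Γ Xh
Γ-co U (X , X⁺) {u} u∈ with ─⁻ u∈
... | u∈U─X , u∉U─X⁺ with ─⁻ u∈U─X | u ∈? X⁺
...   | _   , u∉X | yes u∈X⁺ = ─⁺ u∈X⁺ u∉X
...   | u∈U , _   | no u∉X⁺  = ⊥-elim (u∉U─X⁺ (─⁺ u∈U u∉X⁺))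

co-∩ : ∀ {m} (U : Subset m) (Xh Yh : Biset m) → co U Xh ∩ᵇ co U Yh ≡ co U (Xh ∪ᵇ Yh)
co-∩ U (X , X⁺) (Y , Y⁺) = cong₂ _,_ (─-∩ U X⁺ Y⁺) (─-∩ U X Y)

co-∪ : ∀ {m} (U : Subset m) (Xh Yh : Biset m) → co U Xh ∪ᵇ co U Yh ≡ co U (Xh ∩ᵇ Yh)
co-∪ U (X , X⁺) (Y , Y⁺) = cong₂ _,_ (─-∪ U X⁺ Y⁺) (─-∪ U X Y)

restrict : ∀ {m} → Subset m → Biset m → Biset m
restrict T (X , X⁺) = (X ∩ T , X⁺ ∩ T)

restrict-∩ : ∀ {m} (T : Subset m) (Xh Yh : Biset m) →
  restrict T Xh ∩ᵇ restrict T Yh ≡ restrict T (Xh ∩ᵇ Yh)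
restrict-∩ T (X , X⁺) (Y , Y⁺) = cong₂ _,_ (∩-restrict X Y T) (∩-restrict X⁺ Y⁺ T)

restrict-∪ : ∀ {m} (T : Subset m) (Xh Yh : Biset m) →
  restrict T Xh ∪ᵇ restrict T Yh ≡ restrict T (Xh ∪ᵇ Yh)
restrict-∪ T (X , X⁺) (Y , Y⁺) = cong₂ _,_ (∪-restrict X Y T) (∪-restrict X⁺ Y⁺ T)

Γ-restrict : ∀ {m} (T : Subset m) (Xh : Biset m) → Γ (restrict T Xh) ⊆ Γ Xh
Γ-restrict T (X , X⁺) u∈ with ─⁻ u∈
... | u∈X⁺T , u∉XT = ─⁺ (proj₁ (∩⁻ u∈X⁺T)) (λ u∈X → u∉XT (∩⁺ u∈X (proj₂ (∩⁻ u∈X⁺T))))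

star-restrict : ∀ {m} (T : Subset m) (Xh Yh : Biset m) →
  star T (restrict T Xh) ∩ star T (restrict T Yh) ≡ (⊤ ─ proj₂ (Xh ∪ᵇ Yh)) ∩ T
star-restrict T (X , X⁺) (Y , Y⁺) = begin
  (T ─ (X⁺ ∩ T)) ∩ (T ─ (Y⁺ ∩ T))  ≡⟨ ─-∩ T (X⁺ ∩ T) (Y⁺ ∩ T) ⟩
  T ─ ((X⁺ ∩ T) ∪ (Y⁺ ∩ T))        ≡⟨ cong (T ─_) (∪-restrict X⁺ Y⁺ T) ⟩
  T ─ ((X⁺ ∪ Y⁺) ∩ T)              ≡⟨ complement-restrict (X⁺ ∪ Y⁺) T ⟩
  (⊤ ─ (X⁺ ∪ Y⁺)) ∩ T              ∎
  where open ≡-Reasoning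

star-co-restrict : ∀ {m} (T : Subset m) (Xh Yh : Biset m) →
  proj₁ (Xh ∩ᵇ Yh) ∩ T ⊆ star T (co T (restrict T Xh)) ∩ star T (co T (restrict T Yh))
star-co-restrict T (X , X⁺) (Y , Y⁺) z∈ with ∩⁻ z∈
... | z∈X∩Y , z∈T =
  ∩⁺ (─⁺ z∈T (λ z∈' → proj₂ (─⁻ z∈') (∩⁺ (proj₁ (∩⁻ z∈X∩Y)) z∈T)))
     (─⁺ z∈T (λ z∈' → proj₂ (─⁻ z∈') (∩⁺ (proj₂ (∩⁻ z∈X∩Y)) z∈T)))

reverse-intro : ∀ {m} {T : Subset m} {F : Family m} (Xh : Biset m) → F Xh → reverse T F (co T Xh)
reverse-intro (X , X⁺) X∈F = (X , X⁺) , X∈F , refl , refl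

∉-complement : ∀ {m} {z : Fin m} {T B : Subset m} → z ∈ T → z ∉ T ─ B → z ∈ B
∉-complement {z = z} {B = B} z∈T z∉T─B with z ∈? B
... | yes z∈B = z∈B
... | no z∉B  = ⊥-elim (z∉T─B (─⁺ z∈T z∉B))

reverse-bisetFamily : ∀ {m} {T : Subset m} {F : Family m} →
  BisetFamilyOn T F → BisetFamilyOn T (reverse T F)
reverse-bisetFamily onT _ ((B , B⁺) , B∈F , refl , refl) =
  (λ x∈ → ─⁺ (proj₁ (─⁻ x∈)) (proj₂ (─⁻ x∈) ∘ proj₁ (onT _ B∈F))) , (proj₁ ∘ ─⁻)

-- Two reversed members cross exactly when the original members cross
-- (inside and outside swap), and complementation swaps ∩ and ∪.
reverse-crossing : ∀ {m} {T : Subset m} {F : Family m} → Crossing T F → Crossing T (reverse T F)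
reverse-crossing {T = T} {F} cross _ _ (Bh@(B , B⁺) , B∈F , refl , refl) (Dh@(D , D⁺) , D∈F , refl , refl)
  ((w , w∈) , (z , z∈)) =
  subst (reverse T F) (sym (co-∩ T Bh Dh)) (reverse-intro (Bh ∪ᵇ Dh) (proj₂ closed)) ,
  subst (reverse T F) (sym (co-∪ T Bh Dh)) (reverse-intro (Bh ∩ᵇ Dh) (proj₁ closed))
  where
  z∈B∩D : z ∈ B ∩ D
  z∈B∩D with ∩⁻ z∈
  ... | z∈₁ , z∈₂ with ─⁻ z∈₁ | ─⁻ z∈₂
  ...   | z∈T , z∉₁ | _ , z∉₂ = ∩⁺ (∉-complement z∈T z∉₁) (∉-complement z∈T z∉₂)
  closed : F (Bh ∩ᵇ Dh) × F (Bh ∪ᵇ Dh)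
  closed = cross Bh Dh B∈F D∈F ((z , z∈B∩D) , (w , w∈))

regular-via-crossing : ∀ {m} {T : Subset m} {k : ℕ} {F : Family m} →
  Crossing T F → (∀ Xh → F Xh → ∣ Γ Xh ∣ ≤ k) →
  (∀ Xh Yh → F Xh → F Yh → Intersect Xh Yh → ∣ proj₁ Xh ∪ proj₁ Yh ∣ + k + 1 ≤ ∣ T ∣ →
     Nonempty (star T Xh ∩ star T Yh)) →
  Regular T k F
regular-via-crossing cross Γ≤k small⇒far =
  Γ≤k , λ Xh Yh X∈F Y∈F meet small → cross Xh Yh X∈F Y∈F (meet , small⇒far Xh Yh X∈F Y∈F meet small)

Closed : ∀ {m} → Graph m → Biset m → Set
Closed E (Z , Z⁺) = Z ⊆ Z⁺ × (∀ {x u} → x ∈ Z → E x u → u ∈ Z⁺)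

Splits : ∀ {m} → Subset m → Biset m → Set
Splits T (Z , Z⁺) = Nonempty (Z ∩ T) × Nonempty ((⊤ ─ Z⁺) ∩ T)

closed-∩ : ∀ {m} {E : Graph m} (Xh Yh : Biset m) → Closed E Xh → Closed E Yh → Closed E (Xh ∩ᵇ Yh)
closed-∩ _ _ (X⊆X⁺ , X-out) (Y⊆Y⁺ , Y-out) =
  (λ x∈ → ∩⁺ (X⊆X⁺ (proj₁ (∩⁻ x∈))) (Y⊆Y⁺ (proj₂ (∩⁻ x∈)))) ,
  (λ x∈ e → ∩⁺ (X-out (proj₁ (∩⁻ x∈)) e) (Y-out (proj₂ (∩⁻ x∈)) e))

closed-∪ : ∀ {m} {E : Graph m} (Xh Yh : Biset m) → Closed E Xh → Closed E Yh → Closed E (Xh ∪ᵇ Yh)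
closed-∪ _ _ (X⊆X⁺ , X-out) (Y⊆Y⁺ , Y-out) =
  (λ x∈ → x∈p∪q⁺ (⊎-map X⊆X⁺ Y⊆Y⁺ (∪⁻ x∈))) ,
  (λ x∈ e → x∈p∪q⁺ (⊎-map (λ x∈X → X-out x∈X e) (λ x∈Y → Y-out x∈Y e) (∪⁻ x∈)))

closed-co : ∀ {m} {E : Graph m} → Undirected E → (Xh : Biset m) → Closed E Xh → Closed E (co ⊤ Xh)
closed-co symmetric _ (X⊆X⁺ , X-out) =
  (λ x∈ → ─⁺ ∈⊤ (proj₂ (─⁻ x∈) ∘ X⊆X⁺)) ,
  (λ x∈ e → ─⁺ ∈⊤ (λ u∈X → proj₂ (─⁻ x∈) (X-out u∈X (symmetric _ _ e))))

splits-co : ∀ {m} {T : Subset m} (Xh : Biset m) → Splits T Xh → Splits T (co ⊤ Xh)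
splits-co _ (inner , (s , s∈)) = (s , s∈) , (v , outside⁺ (λ v∈⊤─X → proj₂ (─⁻ v∈⊤─X) v∈X) v∈T)
  where
  v = proj₁ inner
  v∈X = proj₁ (∩⁻ (proj₂ inner))
  v∈T = proj₂ (∩⁻ (proj₂ inner))

record LeavingEdge {m} (E : Graph m) (Z : Subset m) (xs : List (Fin m)) : Set where
  field
    source    : Fin m
    target    : Fin m
    source∈Z  : source ∈ Z
    target∉Z  : target ∉ Z
    edge      : E source target
    target∈xs : target ∈ₗ xs

leaving-edge : ∀ {m} {E : Graph m} (Z : Subset m) {x w : Fin m} {xs : List (Fin m)} →
  x ∈ Z → Linked E (x ∷ xs) → w ∈ₗ xs → w ∉ Z → LeavingEdge E Z xs
leaving-edge Z {xs = y ∷ ys} x∈Z (e ∷ walk) w∈ w∉Z with y ∈? Z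
... | no y∉Z = record
  { source = _ ; target = y ; source∈Z = x∈Z ; target∉Z = y∉Z ; edge = e ; target∈xs = here refl }
... | yes y∈Z with w∈
...   | here refl  = ⊥-elim (w∉Z y∈Z)
...   | there w∈ys = record
  { source = source ; target = target ; source∈Z = source∈Z ; target∉Z = target∉Z ; edge = edge
  ; target∈xs = there target∈xs }
  where open LeavingEdge (leaving-edge Z y∈Z walk w∈ys w∉Z)

record Exits {m} (E : Graph m) (k : ℕ) (Zh : Biset m) : Set where
  field
    exit      : Fin k → Fin m
    injective : Injective _≡_ _≡_ exit
    exit∈Γ    : ∀ i → exit i ∈ Γ Zh
    entered   : ∀ i → ∃ λ x → x ∈ proj₁ Zh × E x (exit i)

-- Menger's theorem, easy direction: each of the k internally-disjoint paths
-- from a terminal in Z to a terminal outside Z⁺ leaves Z through an internal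
-- vertex of Γ(Z , Z⁺), and disjointness makes these exits distinct.
exits : ∀ {m} {E : Graph m} {T : Subset m} {k : ℕ} → KConnected E T k →
  (Zh : Biset m) → Closed E Zh → Splits T Zh → Exits E k Zh
exits {E = E} {T} {k} conn (Z , Z⁺) (Z⊆Z⁺ , Z-out) ((v , v∈) , (s , s∈)) = record
  { exit = exit ; injective = exit-injective ; exit∈Γ = exit∈Γ ; entered = entered }
  where
  open LeavingEdge
  v∈Z = proj₁ (∩⁻ v∈)
  s∉Z⁺ = proj₁ (outside⁻ s∈)
  paths : InternallyDisjointPaths E k v s
  paths = conn s v (proj₂ (outside⁻ s∈)) (proj₂ (∩⁻ v∈)) (λ { refl → s∉Z⁺ (Z⊆Z⁺ v∈Z) })
  P = proj₁ paths
  leave : ∀ i → LeavingEdge E Z (inner (P i) ++ s ∷ [])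
  leave i = leaving-edge Z v∈Z (linked (P i)) (∈-++⁺ʳ (inner (P i)) (here refl)) (s∉Z⁺ ∘ Z⊆Z⁺)
  exit : Fin k → Fin _
  exit i = target (leave i)
  exit∈Z⁺ : ∀ i → exit i ∈ Z⁺
  exit∈Z⁺ i = Z-out (source∈Z (leave i)) (edge (leave i))
  exit∈Γ : ∀ i → exit i ∈ Z⁺ ─ Z
  exit∈Γ i = ─⁺ (exit∈Z⁺ i) (target∉Z (leave i))
  entered : ∀ i → ∃ λ x → x ∈ Z × E x (exit i)
  entered i = source (leave i) , source∈Z (leave i) , edge (leave i)
  -- The exit is not the endpoint s, which lies outside Z⁺.
  exit-internal : ∀ i → exit i ∈ₗ inner (P i)
  exit-internal i with ∈-++⁻ (inner (P i)) (target∈xs (leave i))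
  ... | inj₁ internal     = internal
  ... | inj₂ (here exit≡s) = ⊥-elim (s∉Z⁺ (subst (_∈ Z⁺) exit≡s (exit∈Z⁺ i)))
  exit-injective : Injective _≡_ _≡_ exit
  exit-injective {i} {j} same with i ≟ j
  ... | yes i≡j = i≡j
  ... | no i≢j  = ⊥-elim (proj₂ paths i j i≢j (exit i) (exit-internal i)
                            (subst (_∈ₗ inner (P j)) (sym same) (exit-internal j)))

k≤∣Γ∣ : ∀ {m} {E : Graph m} {T : Subset m} {k : ℕ} → KConnected E T k →
  (Zh : Biset m) → Closed E Zh → Splits T Zh → k ≤ ∣ Γ Zh ∣
k≤∣Γ∣ conn Zh closed splits = injection-≤ exit injective exit∈Γ
  where open Exits (exits conn Zh closed splits)

module TightBisets {m} (E : Graph m) (T : Subset m) (k : ℕ) (conn : KConnected E T k) where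

  tight-closed : (Xh : Biset m) → Tight E T k Xh → Closed E Xh
  tight-closed (X , X⁺) (X⊆X⁺ , _ , _ , neighbourhood , _) = X⊆X⁺ , out
    where
    out : ∀ {x u} → x ∈ X → E x u → u ∈ X⁺
    out {x} {u} x∈X e with u ∈? X
    ... | yes u∈X = proj₂ (neighbourhood u) (inj₁ u∈X)
    ... | no u∉X  = proj₂ (neighbourhood u) (inj₂ (u∉X , x , x∈X , e))

  tight-splits : (Xh : Biset m) → Tight E T k Xh → Splits T Xh
  tight-splits (X , X⁺) (_ , inner , outer , _) = inner , outer

  tight-∣Γ∣ : (Xh : Biset m) → Tight E T k Xh → ∣ Γ Xh ∣ ≡ k
  tight-∣Γ∣ (X , X⁺) (_ , _ , _ , _ , size) = size

  -- A closed biset splitting T with at most k boundary vertices is tight: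
  -- by pigeonhole its k exits fill the boundary, so every boundary vertex
  -- is an out-neighbour of Z.
  tight-intro : (Zh : Biset m) → Closed E Zh → Splits T Zh → ∣ Γ Zh ∣ ≤ k → Tight E T k Zh
  tight-intro Zh@(Z , Z⁺) closed@(Z⊆Z⁺ , Z-out) splits@(inner , outer) Γ≤k =
    Z⊆Z⁺ , inner , outer , (λ u → neighbour u , back u) , ≤-antisym Γ≤k (k≤∣Γ∣ conn Zh closed splits)
    where
    open Exits (exits conn Zh closed splits)
    neighbour : ∀ u → u ∈ Z⁺ → u ∈ Z ⊎ (u ∉ Z × ∃ λ x → x ∈ Z × E x u)
    neighbour u u∈Z⁺ with u ∈? Z
    ... | yes u∈Z = inj₁ u∈Z
    ... | no u∉Z with injection-onto exit injective exit∈Γ Γ≤k (─⁺ u∈Z⁺ u∉Z)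
    ...   | i , refl = inj₂ (u∉Z , entered i)
    back : ∀ u → u ∈ Z ⊎ (u ∉ Z × ∃ λ x → x ∈ Z × E x u) → u ∈ Z⁺
    back u (inj₁ u∈Z)               = Z⊆Z⁺ u∈Z
    back u (inj₂ (_ , x , x∈Z , e)) = Z-out x∈Z e

  boundary-sum : (Xh Yh : Biset m) → Tight E T k Xh → Tight E T k Yh →
    ∣ Γ (Xh ∩ᵇ Yh) ∣ + ∣ Γ (Xh ∪ᵇ Yh) ∣ ≤ k + k
  boundary-sum Xh Yh tX tY =
    subst₂ (λ a b → _ ≤ a + b) (tight-∣Γ∣ Xh tX) (tight-∣Γ∣ Yh tY) (Γ-submodular Xh Yh)

  Γ∪≤k : (Xh Yh : Biset m) → Tight E T k Xh → Tight E T k Yh → Splits T (Xh ∩ᵇ Yh) →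
    ∣ Γ (Xh ∪ᵇ Yh) ∣ ≤ k
  Γ∪≤k Xh Yh tX tY splits =
    ≤-from-sum (boundary-sum Xh Yh tX tY)
      (k≤∣Γ∣ conn (Xh ∩ᵇ Yh) (closed-∩ Xh Yh (tight-closed Xh tX) (tight-closed Yh tY)) splits)

  Γ∩≤k : (Xh Yh : Biset m) → Tight E T k Xh → Tight E T k Yh → Splits T (Xh ∪ᵇ Yh) →
    ∣ Γ (Xh ∩ᵇ Yh) ∣ ≤ k
  Γ∩≤k Xh Yh tX tY splits =
    ≤-from-sum (subst (_≤ k + k) (+-comm ∣ Γ (Xh ∩ᵇ Yh) ∣ ∣ Γ (Xh ∪ᵇ Yh) ∣) (boundary-sum Xh Yh tX tY))
      (k≤∣Γ∣ conn (Xh ∪ᵇ Yh) (closed-∪ Xh Yh (tight-closed Xh tX) (tight-closed Yh tY)) splits)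

  tight-∩-∪ : (Xh Yh : Biset m) → Tight E T k Xh → Tight E T k Yh →
    Nonempty (proj₁ (Xh ∩ᵇ Yh) ∩ T) → Nonempty ((⊤ ─ proj₂ (Xh ∪ᵇ Yh)) ∩ T) →
    Tight E T k (Xh ∩ᵇ Yh) × Tight E T k (Xh ∪ᵇ Yh)
  tight-∩-∪ Xh@(X , X⁺) Yh@(Y , Y⁺) tX tY inner outer =
    tight-intro (Xh ∩ᵇ Yh) (closed-∩ Xh Yh cX cY) split∩ (Γ∩≤k Xh Yh tX tY split∪) ,
    tight-intro (Xh ∪ᵇ Yh) (closed-∪ Xh Yh cX cY) split∪ (Γ∪≤k Xh Yh tX tY split∩)
    where
    cX = tight-closed Xh tX
    cY = tight-closed Yh tY
    split∩ : Splits T (Xh ∩ᵇ Yh)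
    split∩ = inner , outside-anti (∩⊆∪ X⁺ Y⁺) outer
    split∪ : Splits T (Xh ∪ᵇ Yh)
    split∪ = inside-mono (∩⊆∪ X Y) inner , outer

  -- Tight bisets meeting in a terminal, whose union contains at most
  -- |T| - k - 1 terminals, have a common terminal outside: otherwise T is
  -- covered by (X ∪ Y) ∩ T and Γ(X̂ ∪ Ŷ), which has at most k vertices.
  common-outside : (Xh Yh : Biset m) → Tight E T k Xh → Tight E T k Yh →
    Nonempty (proj₁ (Xh ∩ᵇ Yh) ∩ T) → ∣ proj₁ (Xh ∪ᵇ Yh) ∩ T ∣ + k + 1 ≤ ∣ T ∣ →
    Nonempty ((⊤ ─ proj₂ (Xh ∪ᵇ Yh)) ∩ T)
  common-outside Xh@(X , X⁺) Yh@(Y , Y⁺) tX tY inner small with nonempty? ((⊤ ─ (X⁺ ∪ Y⁺)) ∩ T)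
  ... | yes outer = outer
  ... | no none   = ⊥-elim (¬-covered covered (Γ∪≤k Xh Yh tX tY split∩) small)
    where
    split∩ : Splits T (Xh ∩ᵇ Yh)
    split∩ = inner , outside-anti (p∩q⊆p X⁺ Y⁺) (proj₂ (tight-splits Xh tX))
    covered : T ⊆ ((X ∪ Y) ∩ T) ∪ Γ (Xh ∪ᵇ Yh)
    covered {i} i∈T with i ∈? X ∪ Y
    ... | yes i∈X∪Y = x∈p∪q⁺ (inj₁ (∩⁺ i∈X∪Y i∈T))
    ... | no i∉X∪Y  = x∈p∪q⁺ (inj₂ (─⁺ (inside-of-no-outside none i∈T) i∉X∪Y))

  common-inside : (Xh Yh : Biset m) → Tight E T k Xh → Tight E T k Yh →
    Nonempty ((⊤ ─ proj₂ (Xh ∪ᵇ Yh)) ∩ T) →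
    ∣ ((⊤ ─ proj₂ Xh) ∩ T) ∪ ((⊤ ─ proj₂ Yh) ∩ T) ∣ + k + 1 ≤ ∣ T ∣ →
    Nonempty (proj₁ (Xh ∩ᵇ Yh) ∩ T)
  common-inside Xh@(X , X⁺) Yh@(Y , Y⁺) tX tY outer small with nonempty? ((X ∩ Y) ∩ T)
  ... | yes inner = inner
  ... | no none   = ⊥-elim (¬-covered covered (Γ∩≤k Xh Yh tX tY split∪) small)
    where
    split∪ : Splits T (Xh ∪ᵇ Yh)
    split∪ = inside-mono (p⊆p∪q Y) (proj₁ (tight-splits Xh tX)) , outer
    covered : T ⊆ (((⊤ ─ X⁺) ∩ T) ∪ ((⊤ ─ Y⁺) ∩ T)) ∪ Γ (Xh ∩ᵇ Yh)
    covered {i} i∈T with i ∈? X⁺ | i ∈? Y⁺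
    ... | no i∉X⁺  | _        = x∈p∪q⁺ (inj₁ (x∈p∪q⁺ (inj₁ (outside⁺ i∉X⁺ i∈T))))
    ... | yes _    | no i∉Y⁺  = x∈p∪q⁺ (inj₁ (x∈p∪q⁺ (inj₂ (outside⁺ i∉Y⁺ i∈T))))
    ... | yes i∈X⁺ | yes i∈Y⁺ = x∈p∪q⁺ (inj₂ (─⁺ (∩⁺ i∈X⁺ i∈Y⁺) (λ i∈X∩Y → none (i , ∩⁺ i∈X∩Y i∈T))))

  tight-co : Undirected E → (Xh : Biset m) → Tight E T k Xh → Tight E T k (co ⊤ Xh)
  tight-co symmetric Xh tX =
    tight-intro (co ⊤ Xh) (closed-co symmetric Xh (tight-closed Xh tX)) (splits-co Xh (tight-splits Xh tX))
      (≤-trans (p⊆q⇒∣p∣≤∣q∣ (Γ-co ⊤ Xh)) (≤-reflexive (tight-∣Γ∣ Xh tX)))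

  F : Family m
  F = tightFamily E T k

  tight-member : (Xh : Biset m) → Tight E T k Xh → F (restrict T Xh)
  tight-member (X , X⁺) tX = (X , X⁺) , tX , refl , refl

  F-on-T : BisetFamilyOn T F
  F-on-T _ ((X , X⁺) , tX , refl , refl) = (λ x∈ → ∩⁺ (proj₁ tX (proj₁ (∩⁻ x∈))) (proj₂ (∩⁻ x∈))) , (proj₂ ∘ ∩⁻)

  F-Γ≤k : ∀ Xh → F Xh → ∣ Γ Xh ∣ ≤ k
  F-Γ≤k _ (Xh , tX , refl , refl) = ≤-trans (p⊆q⇒∣p∣≤∣q∣ (Γ-restrict T Xh)) (≤-reflexive (tight-∣Γ∣ Xh tX))

  -- Crossing traces come from tight bisets with a common terminal inside and
  -- outside, whose intersection and union are tight.
  F-crossing : Crossing T F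
  F-crossing (A , A⁺) (B , B⁺) (Xh@(X , X⁺) , tX , refl , refl) (Yh@(Y , Y⁺) , tY , refl , refl) (meet , outer) =
    subst F (sym (restrict-∩ T Xh Yh)) (tight-member (Xh ∩ᵇ Yh) (proj₁ tight)) ,
    subst F (sym (restrict-∪ T Xh Yh)) (tight-member (Xh ∪ᵇ Yh) (proj₂ tight))
    where
    tight = tight-∩-∪ Xh Yh tX tY (subst Nonempty (∩-restrict X Y T) meet)
                                  (subst Nonempty (star-restrict T Xh Yh) outer)

  F-regular : Regular T k F
  F-regular = regular-via-crossing F-crossing F-Γ≤k small⇒far
    where
    small⇒far : ∀ Xh Yh → F Xh → F Yh → Intersect Xh Yh → ∣ proj₁ Xh ∪ proj₁ Yh ∣ + k + 1 ≤ ∣ T ∣ →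
      Nonempty (star T Xh ∩ star T Yh)
    small⇒far (A , A⁺) (B , B⁺) (Xh@(X , X⁺) , tX , refl , refl) (Yh@(Y , Y⁺) , tY , refl , refl) meet small =
      subst Nonempty (sym (star-restrict T Xh Yh))
        (common-outside Xh Yh tX tY (subst Nonempty (∩-restrict X Y T) meet)
                                    (subst (λ S → ∣ S ∣ + k + 1 ≤ ∣ T ∣) (∪-restrict X Y T) small))

  F̄ : Family m
  F̄ = reverse T F

  F̄-regular : Regular T k F̄
  F̄-regular = regular-via-crossing (reverse-crossing F-crossing) F̄-Γ≤k small⇒far
    where
    F̄-Γ≤k : ∀ Xh → F̄ Xh → ∣ Γ Xh ∣ ≤ k
    F̄-Γ≤k _ (Bh , B∈F , refl , refl) = ≤-trans (p⊆q⇒∣p∣≤∣q∣ (Γ-co T Bh)) (F-Γ≤k Bh B∈F)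
    small⇒far : ∀ Xh Yh → F̄ Xh → F̄ Yh → Intersect Xh Yh → ∣ proj₁ Xh ∪ proj₁ Yh ∣ + k + 1 ≤ ∣ T ∣ →
      Nonempty (star T Xh ∩ star T Yh)
    small⇒far (A , A⁺) (C , C⁺) (_ , (Xh@(X , X⁺) , tX , refl , refl) , refl , refl)
                                (_ , (Yh@(Y , Y⁺) , tY , refl , refl) , refl , refl) meet small
      with common-inside Xh Yh tX tY (subst Nonempty (star-restrict T Xh Yh) meet)
             (subst (λ S → ∣ S ∣ + k + 1 ≤ ∣ T ∣)
                    (cong₂ _∪_ (complement-restrict X⁺ T) (complement-restrict Y⁺ T)) small)
    ... | z , z∈ = z , star-co-restrict T Xh Yh z∈

  F-symmetric : Undirected E → SameFamily F F̄
  F-symmetric symmetric (A , A⁺) = to , from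
    where
    to : F (A , A⁺) → F̄ (A , A⁺)
    to (Xh@(X , X⁺) , tX , refl , refl) =
      restrict T (co ⊤ Xh) , tight-member (co ⊤ Xh) (tight-co symmetric Xh tX) ,
      restrict-as-complement X T , restrict-as-complement X⁺ T
    from : F̄ (A , A⁺) → F (A , A⁺)
    from (_ , (Xh@(X , X⁺) , tX , refl , refl) , refl , refl) =
      co ⊤ Xh , tight-co symmetric Xh tX , complement-restrict X⁺ T , complement-restrict X T

-- Corollary 2.3.
corollary2p3 : (n : ℕ) (E : Graph n) (T : Subset n) (k : ℕ) →
    Independent E T → KConnected E T k →
    (BisetFamilyOn T (tightFamily E T k) ×
     Crossing T (tightFamily E T k) ×
     Regular T k (tightFamily E T k) ×
     BisetFamilyOn T (reverse T (tightFamily E T k)) ×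
     Crossing T (reverse T (tightFamily E T k)) ×
     Regular T k (reverse T (tightFamily E T k))) ×
    (Undirected E → SameFamily (tightFamily E T k) (reverse T (tightFamily E T k)))
corollary2p3 n E T k _ conn =
  (F-on-T , F-crossing , F-regular , reverse-bisetFamily F-on-T , reverse-crossing F-crossing , F̄-regular) ,
  F-symmetric
  where open TightBisets E T k conn
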